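{- Let $\mathcal{A}=(Q,E,s,F)$ be a Wheeler GNFA (possibly with $\epsilon$-transitions), let $\le$ be a Wheeler order on $\mathcal{A}$, and let $\alpha\in\Sigma^*$. Then: (1) $G^\prec(\alpha)\cap G_\dashv(\alpha)=\emptyset$; (2) $G_\dashv(\alpha)$ is $\le$-convex; (3) if $u,v\in Q$, $u<v$ and $v\in G^\prec(\alpha)$, then $u\in G^\prec(\alpha)$; i.e., $G^\prec(\alpha)=Q[1,|G^\prec(\alpha)|]$; (4) if $u,v\in Q$, $u<v$ and $v\in G^\prec_\dashv(\alpha)$, then $u\in G^\prec_\dashv(\alpha)$; i.e., $G^\prec_\dashv(\alpha)=Q[1,|G^\prec_\dashv(\alpha)|]$; (5) $G_\dashv(\alpha)=Q[|G^\prec(\alpha)|+1,|G^\prec_\dashv(\alpha)|]$.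
   Context: $\Sigma$ is a finite alphabet with a fixed total order $\preceq$, extended co-lexicographically to $\Sigma^*$ (compare reversed strings lexicographically). $\epsilon$ is the empty string; $\alpha\dashv\beta$ means $\alpha$ is a suffix of $\beta$. A GNFA is $\mathcal{A}=(Q,E,s,F)$ with finite state set $Q$, finite edge set $E\subseteq Q\times Q\times\Sigma^*$ (labels may be $\epsilon$), initial state $s$, final states $F$; every state is reachable from $s$ and is final or can reach a final state. For $u\in Q$, $I_u$ is the set of strings $\alpha_1\cdots\alpha_{t-1}$ with states $u_1=s,\dots,u_t=u$ ($t\ge1$) and $(u_i,u_{i+1},\alpha_i)\in E$. $u\preceq_{\mathcal{A}}v$ iff for all $\alpha\in I_u,\beta\in I_v$ with $\{\alpha,\beta\}\not\subseteq I_u\cap I_v$ we have $\alpha\prec\beta$. A Wheeler order is a total order $\le$ on $Q$ such that: (1) $u\le v\Rightarrow u\preceq_{\mathcal{A}}v$; (2) $s$ is $\le$-minimum; (3) for $(u',u,\rho),(v',v,\rho')\in E$, if $u<v$ and $\rho'$ is not a strict suffix of $\rho$ then $\rho\preceq\rho'$; (4) for $(u',u,\rho),(v',v,\rho)\in E$, if $u<v$ then $u'\le v'$. $\mathcal{A}$ is Wheeler if it has a Wheeler order. Write $Q=\{Q[1],\dots,Q[|Q|]\}$ with $Q[1]<\dots<Q[|Q|]$, $Q[i,j]=\{Q[i],\dots,Q[j]\}$ for $i\le j$ and $Q[i,j]=\emptyset$ for $i>j$. A set $U\subseteq Q$ is $\le$-convex if $u<v<z$ with $u,z\in U$ implies $v\in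 U$. Define $G^\prec(\alpha)=\{u\in Q: \forall\beta\in I_u,\ \beta\prec\alpha\}$, $G_\dashv(\alpha)=\{u\in Q:\exists\beta\in I_u,\ \alpha\dashv\beta\}$, and $G^\prec_\dashv(\alpha)=G^\prec(\alpha)\cup G_\dashv(\alpha)$. -}

module Defs where

open import Level using (0ℓ)
open import Data.Nat as ℕ using (ℕ; suc)
open import Data.Fin as Fin using (Fin)
open import Data.Fin.Subset as Subset using (Subset)
open import Data.List using (List; []; _++_; reverse)
open import Data.List.Membership.Propositional using (_∈_)
open import Data.List.Relation.Binary.Lex.Strict using (Lex-<)
open import Data.Product using (Σ; ∃; ∃-syntax; _×_; _,_)
open import Data.Sum using (_⊎_)
open import Function.Definitions using (Injective)
open import Relation.Nullary using (¬_)
open import Relation.Binary.Core using (Rel)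
open import Relation.Binary.Structures using (IsTotalOrder)
open import Relation.Binary.PropositionalEquality using (_≡_; _≢_)
open import Relation.Unary using (Pred)

Str : ℕ → Set
Str σ = List (Fin σ)

-- strict co-lexicographic order: compare reversed strings lexicographically
-- (the empty string / a proper prefix is smaller)
_≺_ : ∀ {σ} → Rel (Str σ) 0ℓ
α ≺ β = Lex-< _≡_ Fin._<_ (reverse α) (reverse β)

_⪯_ : ∀ {σ} → Rel (Str σ) 0ℓ
α ⪯ β = α ≺ β ⊎ α ≡ β

_⊣_ : ∀ {σ} → Rel (Str σ) 0ℓ
α ⊣ β = ∃[ γ ] (γ ++ α ≡ β)

StrictSuffix : ∀ {σ} → Rel (Str σ) 0ℓ
StrictSuffix α β = α ⊣ β × α ≢ β

record GNFA (σ n : ℕ) : Set where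
  field
    E : List (Fin n × Fin n × Str σ)   -- finite edge set (labels may be [])
    s : Fin n
    F : Subset n

module _ {σ n : ℕ} (A : GNFA σ n) where
  open GNFA A

  data Path (u : Fin n) : Fin n → Str σ → Set where
    here : Path u u []
    step : ∀ {v w α ρ} → Path u v α → (v , w , ρ) ∈ E → Path u w (α ++ ρ)

  I : Fin n → Pred (Str σ) 0ℓ
  I u α = Path s u α

  record WellFormed : Set where
    field
      reachable   : ∀ u → ∃[ α ] I u α
      coreachable : ∀ u → ∃[ v ] ∃[ α ] (v Subset.∈ F × Path u v α)

  _⪯A_ : Rel (Fin n) 0ℓ
  u ⪯A v = ∀ α β → I u α → I v β →
           ¬ ((I u α × I v α) × (I u β × I v β)) → α ≺ β

  record WheelerOrder : Set₁ where
    field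
      _≤_          : Rel (Fin n) 0ℓ
      isTotalOrder : IsTotalOrder _≡_ _≤_

    _<_ : Rel (Fin n) 0ℓ
    u < v = u ≤ v × u ≢ v

    field
      axiom1 : ∀ u v → u ≤ v → u ⪯A v
      axiom2 : ∀ u → s ≤ u
      axiom3 : ∀ u′ u v′ v ρ ρ′ → (u′ , u , ρ) ∈ E → (v′ , v , ρ′) ∈ E →
               u < v → ¬ StrictSuffix ρ′ ρ → ρ ⪯ ρ′
      axiom4 : ∀ u′ u v′ v ρ → (u′ , u , ρ) ∈ E → (v′ , v , ρ) ∈ E →
               u < v → u′ ≤ v′

  Gprec : Str σ → Pred (Fin n) 0ℓ
  Gprec α u = ∀ β → I u β → β ≺ α

  Gsuf : Str σ → Pred (Fin n) 0ℓ
  Gsuf α u = ∃[ β ] (I u β × α ⊣ β)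

  Gboth : Str σ → Pred (Fin n) 0ℓ
  Gboth α u = Gprec α u ⊎ Gsuf α u

HasSize : ∀ {n} → Pred (Fin n) 0ℓ → ℕ → Set
HasSize {n} P k = Σ (Fin k → Fin n) λ f →
  Injective _≡_ _≡_ f × (∀ u → (P u → ∃[ i ] (f i ≡ u)) × (∃[ i ] (f i ≡ u) → P u))

module _ {σ n : ℕ} {A : GNFA σ n} (W : WheelerOrder A) where
  open WheelerOrder W

  -- Q[i,j] = { Q[p] : i ≤ p ≤ j }, where Q[p] is the state with exactly p
  -- states ≤ it (1-based position); empty if i > j.
  Interval : ℕ → ℕ → Pred (Fin n) 0ℓ
  Interval i j u = ∃[ p ] (HasSize (λ v → v ≤ u) p × i ℕ.≤ p × p ℕ.≤ j)

  Convex : Pred (Fin n) 0ℓ → Set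
  Convex U = ∀ u v z → U u → U z → u < v → v < z → U v

{-# OPTIONS --safe #-}
module Submission where

-- Axiom 1 of a Wheeler order places the strings reaching u co-lexicographically
-- before those reaching any later state v, apart from strings reaching both.
-- The strings having α as a suffix form a co-lexicographic interval whose least
-- element is α.  Hence G^≺(α) is downward closed, and so is G^≺(α) ∪ G_⊣(α): if
-- v is reached by β with suffix α and u < v is reached by no such string, then
-- every string reaching u lies below β, hence below α, as otherwise it would lie
-- between α and β and have suffix α.  With the disjointness of G^≺(α) and G_⊣(α),
-- all claims follow by comparing positions in the order.
-- Constructively, "u is reached by a string with suffix α, or not" requires
-- G_⊣(α) to be decidable; it is, by a finite backward search over pairs of a
-- state and a prefix of α that remains to be read.

open import Defs
open import Data.Nat using (ℕ; suc)
open import Data.Fin using (Fin)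
open import Data.Product using (_×_)
open import Relation.Unary using (Empty; _∩_; _≐_)

open import Level using (0ℓ)
open import Data.Nat as ℕ using (zero; z≤n; s≤s)
import Data.Nat.Properties as ℕ
import Data.Fin as Fin
import Data.Fin.Properties as Fin
open import Data.List
  using (List; []; _∷_; _++_; reverse; inits; filter; length; lookup; allFin; cartesianProduct)
open import Data.List.Properties
  using (∷-injectiveˡ; ∷-injectiveʳ; reverse-injective; ++-assoc; ++-identityʳ; ++-conicalʳ)
import Data.List.Properties as List
open import Data.List.Membership.Propositional using (_∈_; _∉_; find; lose)
open import Data.List.Membership.Propositional.Properties
  using ( ∈-map⁺; ∈-map⁻; ∈-filter⁺; ∈-filter⁻; ∈-lookup; ∈-allFin
        ; ∈-cartesianProduct⁺; ∈-cartesianProduct⁻)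
import Data.List.Relation.Unary.All as All
open import Data.List.Relation.Unary.AllPairs using (_∷_)
open import Data.List.Relation.Unary.Any as Any using (Any; satisfied; any?)
open import Data.List.Relation.Unary.Any.Properties using (lookup-index)
open import Data.List.Relation.Unary.Unique.Propositional using (Unique)
open import Data.List.Relation.Unary.Unique.Propositional.Properties using (allFin⁺; filter⁺)
open import Data.List.Relation.Binary.Lex.Core using (base; this; next)
open import Data.List.Relation.Binary.Lex.Strict using (Lex-<; <-transitive; <-decidable; <-compare)
open import Data.List.Relation.Binary.Pointwise using (Pointwise-≡⇒≡; ≡⇒Pointwise-≡)
open import Data.List.Relation.Binary.Prefix.Heterogeneous using (Prefix; []; _∷_)
open import Data.List.Relation.Binary.Suffix.Heterogeneous using (Suffix; here; there; _++ˢ_)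
open import Data.List.Relation.Binary.Suffix.Heterogeneous.Properties
  using (suffix?; toPrefix-rev; fromPrefix-rev)
import Data.Product.Properties as Product
open import Data.Product using (∃; ∃-syntax; _,_; proj₁; proj₂)
open import Data.Sum using (_⊎_; inj₁; inj₂)
open import Data.Vec.Functional using () renaming (_∷_ to _◂_)
open import Function.Definitions using (Injective)
open import Relation.Binary.Core using (Rel)
open import Relation.Binary.Consequences using (total∧dec⇒dec)
open import Relation.Binary.Definitions using (DecidableEquality; tri<; tri≈; tri>)
import Relation.Binary.Definitions as Binary
open import Relation.Binary.Structures using (IsTotalOrder)
open import Relation.Binary.PropositionalEquality
  using (_≡_; _≢_; refl; sym; cong; subst; isEquivalence; resp₂; module ≡-Reasoning)
open import Relation.Nullary using (¬_; Dec; yes; no; contradiction)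
open import Relation.Nullary.Decidable using (map′; _×-dec_; _⊎-dec_)
open import Relation.Unary using (Pred; Decidable; _⊆_; _∪_)

-- The co-lexicographic order and suffixes

module _ {σ : ℕ} where

  private
    _<ₗ_ : Rel (List (Fin σ)) 0ℓ
    _<ₗ_ = Lex-< _≡_ Fin._<_

  Prefix⇒≮ : ∀ {p x} → Prefix _≡_ p x → ¬ x <ₗ p
  Prefix⇒≮ []          (base ())
  Prefix⇒≮ (refl ∷ pr) (this c<c)  = Fin.<-irrefl refl c<c
  Prefix⇒≮ (refl ∷ pr) (next _ lt) = Prefix⇒≮ pr lt

  Prefix-between : ∀ {p x y} → Prefix _≡_ p y → p <ₗ x → x <ₗ y → Prefix _≡_ p x
  Prefix-between []          _               _               = []
  Prefix-between (refl ∷ pr) (this c<d)      (this d<c)      = contradiction d<c (Fin.<-asym c<d)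
  Prefix-between (refl ∷ pr) (this c<c)      (next refl _)   = contradiction c<c (Fin.<-irrefl refl)
  Prefix-between (refl ∷ pr) (next refl _)   (this c<c)      = contradiction c<c (Fin.<-irrefl refl)
  Prefix-between (refl ∷ pr) (next refl p<x) (next refl x<y) = refl ∷ Prefix-between pr p<x x<y

  ≺-trans : ∀ {α β γ : Str σ} → α ≺ β → β ≺ γ → α ≺ γ
  ≺-trans = <-transitive isEquivalence (resp₂ Fin._<_) Fin.<-trans

  _≺?_ : Binary.Decidable (_≺_ {σ})
  α ≺? β = <-decidable Fin._≟_ Fin._<?_ (reverse α) (reverse β)

  ⊀⇒⪰ : ∀ {α β : Str σ} → ¬ β ≺ α → α ⪯ β
  ⊀⇒⪰ {α} {β} β⊀α with <-compare sym Fin.<-cmp (reverse α) (reverse β)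
  ... | tri< α≺β _ _ = inj₁ α≺β
  ... | tri≈ _ α≡β _ = inj₂ (reverse-injective (Pointwise-≡⇒≡ α≡β))
  ... | tri> _ _ β≺α = contradiction β≺α β⊀α

  ⊣⇒Suffix : ∀ {α β : Str σ} → α ⊣ β → Suffix _≡_ α β
  ⊣⇒Suffix (γ , refl) = γ ++ˢ here (≡⇒Pointwise-≡ refl)

  Suffix⇒⊣ : ∀ {α β : Str σ} → Suffix _≡_ α β → α ⊣ β
  Suffix⇒⊣ (here eq)     = [] , Pointwise-≡⇒≡ eq
  Suffix⇒⊣ (there {b} s) = let γ , eq = Suffix⇒⊣ s in b ∷ γ , cong (b ∷_) eq

  _⊣?_ : Binary.Decidable (_⊣_ {σ})
  α ⊣? β = map′ Suffix⇒⊣ ⊣⇒Suffix (suffix? Fin._≟_ α β)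

  ⊣⇒⊀ : ∀ {α β : Str σ} → α ⊣ β → ¬ β ≺ α
  ⊣⇒⊀ α⊣β = Prefix⇒≮ (toPrefix-rev (⊣⇒Suffix α⊣β))

  ⊣-convex : ∀ {α β γ : Str σ} → α ⪯ γ → γ ≺ β → α ⊣ β → α ⊣ γ
  ⊣-convex (inj₂ refl) _   _   = [] , refl
  ⊣-convex (inj₁ α≺γ) γ≺β α⊣β =
    Suffix⇒⊣ (fromPrefix-rev (Prefix-between (toPrefix-rev (⊣⇒Suffix α⊣β)) α≺γ γ≺β))

  ⊣-++ˡ : ∀ (β : Str σ) {γ ρ} → γ ⊣ ρ → γ ⊣ (β ++ ρ)
  ⊣-++ˡ β (δ , refl) = β ++ δ , ++-assoc β δ _

  ⊣-++ʳ : ∀ (ρ : Str σ) {γ β} → γ ⊣ β → (γ ++ ρ) ⊣ (β ++ ρ)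
  ⊣-++ʳ ρ (δ , refl) = δ , sym (++-assoc δ _ ρ)

  ⊣-++⁻ : ∀ {γ} (β : Str σ) {ρ} → γ ⊣ (β ++ ρ) → γ ⊣ ρ ⊎ ∃[ γ′ ] (γ′ ++ ρ ≡ γ × γ′ ⊣ β)
  ⊣-++⁻ []      γ⊣ρ          = inj₁ γ⊣ρ
  ⊣-++⁻ (b ∷ β) ([] , refl)  = inj₂ (b ∷ β , refl , [] , refl)
  ⊣-++⁻ (b ∷ β) (d ∷ δ , eq) with ⊣-++⁻ β (δ , ∷-injectiveʳ eq)
  ... | inj₁ γ⊣ρ = inj₁ γ⊣ρ
  ... | inj₂ (γ′ , γ′ρ≡γ , η , refl) = inj₂ (γ′ , γ′ρ≡γ , d ∷ η , cong (_∷ _) (∷-injectiveˡ eq))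

  ∈-inits⁺ : ∀ {γ δ α : Str σ} → γ ++ δ ≡ α → γ ∈ inits α
  ∈-inits⁺ {[]}    refl = Any.here refl
  ∈-inits⁺ {c ∷ γ} refl = Any.there (∈-map⁺ (c ∷_) (∈-inits⁺ refl))

  ∈-inits⁻ : ∀ {γ} (α : Str σ) → γ ∈ inits α → ∃[ δ ] γ ++ δ ≡ α
  ∈-inits⁻ α       (Any.here refl) = α , refl
  ∈-inits⁻ (a ∷ α) (Any.there γ∈)  with _ , γ′∈ , refl ← ∈-map⁻ (a ∷_) γ∈ =
    let δ , eq = ∈-inits⁻ α γ′∈ in δ , cong (a ∷_) eq

-- Decidable reachability in a finite graph

data Reaches {X : Set} (T : Pred X 0ℓ) (R : Rel X 0ℓ) : X → Set where
  done : ∀ {x} → T x → Reaches T R x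
  step : ∀ {x y} → R x y → Reaches T R y → Reaches T R x

module _ {X : Set} (_≟_ : DecidableEquality X)
         {T : Pred X 0ℓ} (T? : Decidable T) {R : Rel X 0ℓ} (R? : Binary.Decidable R) where

  open import Data.List.Membership.DecPropositional _≟_ using (_∈?_)
  open import Data.Nat using (_≤_; _<_)

  private
    data Avoiding (V : List X) : X → Set where
      done : ∀ {x} → x ∉ V → T x → Avoiding V x
      step : ∀ {x y} → x ∉ V → R x y → Avoiding V y → Avoiding V x

    head∉ : ∀ {V x} → Avoiding V x → x ∉ V
    head∉ (done x∉V _)   = x∉V
    head∉ (step x∉V _ _) = x∉V

    unvisit : ∀ {V x y} → Avoiding (x ∷ V) y → Avoiding V y
    unvisit (done y∉ ty)  = done (λ y∈ → y∉ (Any.there y∈)) ty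
    unvisit (step y∉ r p) = step (λ y∈ → y∉ (Any.there y∈)) r (unvisit p)

    Avoiding⇒Reaches : ∀ {V x} → Avoiding V x → Reaches T R x
    Avoiding⇒Reaches (done _ tx)  = done tx
    Avoiding⇒Reaches (step _ r p) = step r (Avoiding⇒Reaches p)

    Reaches⇒Avoiding : ∀ {x} → Reaches T R x → Avoiding [] x
    Reaches⇒Avoiding (done tx)  = done (λ ()) tx
    Reaches⇒Avoiding (step r p) = step (λ ()) r (Reaches⇒Avoiding p)

    ∉-∷⁺ : ∀ {V : List X} {x y} → y ≢ x → y ∉ V → y ∉ x ∷ V
    ∉-∷⁺ y≢x _   (Any.here y≡x)  = y≢x y≡x
    ∉-∷⁺ _   y∉V (Any.there y∈V) = y∉V y∈V

    Leaves : List X → X → Set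
    Leaves V x = T x ⊎ ∃[ y ] (R x y × Avoiding (x ∷ V) y)

    -- Cuts the walk at its last visit to x, if there is one.
    avoid-or-leave : ∀ {V y} x → Avoiding V y → Avoiding (x ∷ V) y ⊎ Leaves V x
    avoid-or-leave x (done {y} y∉V ty) with y ≟ x
    ... | yes refl = inj₂ (inj₁ ty)
    ... | no  y≢x  = inj₁ (done (∉-∷⁺ y≢x y∉V) ty)
    avoid-or-leave x (step {y} y∉V r p) with avoid-or-leave x p
    ... | inj₂ leaves = inj₂ leaves
    ... | inj₁ p′ with y ≟ x
    ...   | yes refl = inj₂ (inj₂ (_ , r , p′))
    ...   | no  y≢x  = inj₁ (step (∉-∷⁺ y≢x y∉V) r p′)

    Avoiding⇒Leaves : ∀ {V x} → Avoiding V x → Leaves V x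
    Avoiding⇒Leaves {x = x} p with avoid-or-leave x p
    ... | inj₁ p′     = contradiction (Any.here refl) (head∉ p′)
    ... | inj₂ leaves = leaves

    Leaves⇒Avoiding : ∀ {V x} → x ∉ V → Leaves V x → Avoiding V x
    Leaves⇒Avoiding x∉V (inj₁ tx)          = done x∉V tx
    Leaves⇒Avoiding x∉V (inj₂ (_ , r , p)) = step x∉V r (unvisit p)

    unvisited : List X → List X → ℕ
    unvisited V []       = 0
    unvisited V (y ∷ ys) with y ∈? V
    ... | yes _ = unvisited V ys
    ... | no  _ = suc (unvisited V ys)

    -- Splitting on y ≟ x rather than on y ∈? x ∷ V lets the goal compute.
    unvisited-∷-≤ : ∀ x V ys → unvisited (x ∷ V) ys ≤ unvisited V ys
    unvisited-∷-≤ x V []       = z≤n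
    unvisited-∷-≤ x V (y ∷ ys) with y ≟ x | y ∈? V
    ... | yes _ | yes _ = unvisited-∷-≤ x V ys
    ... | yes _ | no  _ = ℕ.m≤n⇒m≤1+n (unvisited-∷-≤ x V ys)
    ... | no  _ | yes _ = unvisited-∷-≤ x V ys
    ... | no  _ | no  _ = s≤s (unvisited-∷-≤ x V ys)

    unvisited-∷-< : ∀ {x V ys} → x ∈ ys → x ∉ V → unvisited (x ∷ V) ys < unvisited V ys
    unvisited-∷-< {x} {V} {_ ∷ ys} (Any.here refl) x∉V with x ≟ x | x ∈? V
    ... | _       | yes x∈V = contradiction x∈V x∉V
    ... | yes _   | no  _   = s≤s (unvisited-∷-≤ x V ys)
    ... | no  x≢x | no  _   = contradiction refl x≢x
    unvisited-∷-< {x} {V} {y ∷ _} (Any.there x∈ys) x∉V with y ≟ x | y ∈? V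
    ... | yes _ | yes _ = unvisited-∷-< x∈ys x∉V
    ... | yes _ | no  _ = ℕ.m≤n⇒m≤1+n (unvisited-∷-< x∈ys x∉V)
    ... | no  _ | yes _ = unvisited-∷-< x∈ys x∉V
    ... | no  _ | no  _ = s≤s (unvisited-∷-< x∈ys x∉V)

    module _ (L : List X) (L-closed : ∀ {x y} → x ∈ L → R x y → y ∈ L) where

      avoiding? : ∀ k V {x} → unvisited V L ≤ k → x ∈ L → x ∉ V → Dec (Avoiding V x)
      avoiding? zero    V bound x∈L x∉V =
        contradiction (ℕ.≤-trans (unvisited-∷-< x∈L x∉V) bound) λ ()
      avoiding? (suc k) V {x} bound x∈L x∉V =
        map′ (Leaves⇒Avoiding x∉V) Avoiding⇒Leaves
             (T? x ⊎-dec map′ satisfied lose-successor (any? successor? L))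
        where
        bound′ : unvisited (x ∷ V) L ≤ k
        bound′ = ℕ.≤-pred (ℕ.≤-trans (unvisited-∷-< x∈L x∉V) bound)

        successor? : ∀ y → Dec (R x y × Avoiding (x ∷ V) y)
        successor? y with y ∈? L | y ∈? x ∷ V
        ... | no  y∉L | _      = no λ (r , _) → y∉L (L-closed x∈L r)
        ... | yes _   | yes y∈ = no λ (_ , p) → head∉ p y∈
        ... | yes y∈L | no  y∉ = R? x y ×-dec avoiding? k (x ∷ V) bound′ y∈L y∉

        lose-successor : ∃[ y ] (R x y × Avoiding (x ∷ V) y) →
                         Any (λ y → R x y × Avoiding (x ∷ V) y) L
        lose-successor (y , r , p) = lose (L-closed x∈L r) (r , p)

  reaches? : (L : List X) → (∀ {x y} → x ∈ L → R x y → y ∈ L) →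
             ∀ {x} → x ∈ L → Dec (Reaches T R x)
  reaches? L L-closed x∈L =
    map′ Avoiding⇒Reaches Reaches⇒Avoiding (avoiding? L L-closed _ [] ℕ.≤-refl x∈L λ ())

-- Deciding G_⊣(α)

module _ {σ n : ℕ} (A : GNFA σ n) where
  open GNFA A

  -- (w , γ) asks for a walk from s to w whose label ends in γ; it is
  -- answered by searching backwards along the edges, keeping the part of
  -- γ that is still to be produced.
  private
    Node : Set
    Node = Fin n × Str σ

    _≟ₙ_ : DecidableEquality Node
    _≟ₙ_ = Product.≡-dec Fin._≟_ (List.≡-dec Fin._≟_)

    Start : Pred Node 0ℓ
    Start (w , γ) = γ ≡ [] ⊎ Any (λ (_ , v , ρ) → v ≡ w × γ ⊣ ρ) E

    Back : Rel Node 0ℓ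
    Back (w , γ) (w′ , γ′) = Any (λ (u , v , ρ) → u ≡ w′ × v ≡ w × γ′ ++ ρ ≡ γ) E

    Start? : Decidable Start
    Start? (w , γ) = List.≡-dec Fin._≟_ γ [] ⊎-dec any? (λ (_ , v , ρ) → v Fin.≟ w ×-dec γ ⊣? ρ) E

    Back? : Binary.Decidable Back
    Back? (w , γ) (w′ , γ′) =
      any? (λ (u , v , ρ) → u Fin.≟ w′ ×-dec v Fin.≟ w ×-dec List.≡-dec Fin._≟_ (γ′ ++ ρ) γ) E

    Path⇒Reaches : ∀ {w β γ} → Path A s w β → γ ⊣ β → Reaches Start Back (w , γ)
    Path⇒Reaches here (δ , eq) = done (inj₁ (++-conicalʳ δ _ eq))
    Path⇒Reaches (step {α = β} p e∈E) γ⊣βρ with ⊣-++⁻ β γ⊣βρ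
    ... | inj₁ γ⊣ρ              = done (inj₂ (lose e∈E (refl , γ⊣ρ)))
    ... | inj₂ (γ′ , eq , γ′⊣β) = step (lose e∈E (refl , refl , eq)) (Path⇒Reaches p γ′⊣β)

    Reaches⇒Gsuf : WellFormed A → ∀ {w γ} → Reaches Start Back (w , γ) → Gsuf A γ w
    Reaches⇒Gsuf wf {w} (done (inj₁ refl)) =
      let β , p = WellFormed.reachable wf w in β , p , β , ++-identityʳ β
    Reaches⇒Gsuf wf (done (inj₂ start)) with (w′ , _ , ρ) , e∈E , refl , γ⊣ρ ← find start =
      let β , p = WellFormed.reachable wf w′ in β ++ ρ , step p e∈E , ⊣-++ˡ β γ⊣ρ
    Reaches⇒Gsuf wf (step back r) with (_ , _ , ρ) , e∈E , refl , refl , refl ← find back =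
      let β , p , γ′⊣β = Reaches⇒Gsuf wf r in β ++ ρ , step p e∈E , ⊣-++ʳ ρ γ′⊣β

    inits-closed : ∀ α {x y} → x ∈ cartesianProduct (allFin n) (inits α) → Back x y →
                   y ∈ cartesianProduct (allFin n) (inits α)
    inits-closed α {w , γ} {w′ , γ′} x∈ back
      with (_ , _ , ρ) , refl , refl , γ′ρ≡γ ← satisfied back =
      let δ , γδ≡α = ∈-inits⁻ α (proj₂ (∈-cartesianProduct⁻ (allFin n) (inits α) x∈))
          open ≡-Reasoning
      in ∈-cartesianProduct⁺ (∈-allFin w′) (∈-inits⁺ (begin
           γ′ ++ ρ ++ δ   ≡⟨ ++-assoc γ′ ρ δ ⟨
           (γ′ ++ ρ) ++ δ ≡⟨ cong (_++ δ) γ′ρ≡γ ⟩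
           γ ++ δ         ≡⟨ γδ≡α ⟩
           α              ∎))

  Gsuf? : WellFormed A → ∀ α → Decidable (Gsuf A α)
  Gsuf? wf α w =
    map′ (Reaches⇒Gsuf wf) (λ (_ , p , α⊣β) → Path⇒Reaches p α⊣β)
         (reaches? _≟ₙ_ Start? Back? (cartesianProduct (allFin n) (inits α)) (inits-closed α)
                   (∈-cartesianProduct⁺ (∈-allFin w) (∈-inits⁺ (++-identityʳ α))))

-- Sizes of subsets of Fin n

module _ {n : ℕ} where
  open import Data.Nat using (_≤_; _<_)

  Unique⇒lookup-injective : ∀ {xs : List (Fin n)} → Unique xs → Injective _≡_ _≡_ (lookup xs)
  Unique⇒lookup-injective {_ ∷ _} _ {Fin.zero} {Fin.zero} _ = refl
  Unique⇒lookup-injective {_ ∷ _} (x∉xs ∷ _) {Fin.zero} {Fin.suc j} eq =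
    contradiction eq (All.lookup x∉xs (∈-lookup j))
  Unique⇒lookup-injective {_ ∷ _} (x∉xs ∷ _) {Fin.suc i} {Fin.zero} eq =
    contradiction (sym eq) (All.lookup x∉xs (∈-lookup i))
  Unique⇒lookup-injective {_ ∷ _} (_ ∷ xs-unique) {Fin.suc i} {Fin.suc j} eq =
    cong Fin.suc (Unique⇒lookup-injective xs-unique eq)

  hasSize : ∀ {P : Pred (Fin n) 0ℓ} → Decidable P → ∃[ k ] HasSize P k
  hasSize {P} P? = length xs , lookup xs , Unique⇒lookup-injective (filter⁺ P? (allFin⁺ n)) , spec
    where
    xs : List (Fin n)
    xs = filter P? (allFin n)

    spec : ∀ u → (P u → ∃[ i ] lookup xs i ≡ u) × (∃[ i ] lookup xs i ≡ u → P u)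
    spec u = (λ Pu → let u∈xs = ∈-filter⁺ P? (∈-allFin u) Pu in
                       Any.index u∈xs , sym (lookup-index u∈xs))
           , λ { (i , refl) → proj₂ (∈-filter⁻ P? {xs = allFin n} (∈-lookup i)) }

  HasSize⇒Decidable : ∀ {P : Pred (Fin n) 0ℓ} {k} → HasSize P k → Decidable P
  HasSize⇒Decidable (f , _ , spec) u =
    map′ (proj₂ (spec u)) (proj₁ (spec u)) (Fin.any? λ i → f i Fin.≟ u)

  HasSize⇒0< : ∀ {P : Pred (Fin n) 0ℓ} {k u} → HasSize P k → P u → 0 < k
  HasSize⇒0< {k = suc _} _ _ = s≤s z≤n
  HasSize⇒0< {k = zero} (_ , _ , spec) Pu with () ← proj₁ (proj₁ (spec _) Pu)

  HasSize-injective⇒≤ : ∀ {Q : Pred (Fin n) 0ℓ} {a b} (f : Fin a → Fin n) → Injective _≡_ _≡_ f →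
                        (∀ i → Q (f i)) → HasSize Q b → a ≤ b
  HasSize-injective⇒≤ f f-inj Qf (g , _ , spec) = Fin.injective⇒≤ index-inj
    where
    index : Fin _ → Fin _
    index i = proj₁ (proj₁ (spec (f i)) (Qf i))

    index-inj : Injective _≡_ _≡_ index
    index-inj {i} {j} eq = f-inj (begin
      f i             ≡⟨ proj₂ (proj₁ (spec (f i)) (Qf i)) ⟨
      g (index i)     ≡⟨ cong g eq ⟩
      g (index j)     ≡⟨ proj₂ (proj₁ (spec (f j)) (Qf j)) ⟩
      f j             ∎)
      where open ≡-Reasoning

  HasSize-⊆⇒≤ : ∀ {P Q : Pred (Fin n) 0ℓ} {a b} → HasSize P a → HasSize Q b → P ⊆ Q → a ≤ b
  HasSize-⊆⇒≤ (f , f-inj , spec) Q-size P⊆Q =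
    HasSize-injective⇒≤ f f-inj (λ i → P⊆Q (proj₂ (spec (f i)) (i , refl))) Q-size

  HasSize-⊂⇒< : ∀ {P Q : Pred (Fin n) 0ℓ} {a b u} → HasSize P a → HasSize Q b → P ⊆ Q →
                Q u → ¬ P u → a < b
  HasSize-⊂⇒< {P} {Q} {u = u} (f , f-inj , spec) Q-size P⊆Q Qu ¬Pu =
    HasSize-injective⇒≤ (u ◂ f) u◂f-inj Q[u◂f] Q-size
    where
    Pf : ∀ i → P (f i)
    Pf i = proj₂ (spec (f i)) (i , refl)

    u◂f-inj : Injective _≡_ _≡_ (u ◂ f)
    u◂f-inj {Fin.zero}  {Fin.zero}  _  = refl
    u◂f-inj {Fin.zero}  {Fin.suc j} eq = contradiction (subst P (sym eq) (Pf j)) ¬Pu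
    u◂f-inj {Fin.suc i} {Fin.zero}  eq = contradiction (subst P eq (Pf i)) ¬Pu
    u◂f-inj {Fin.suc i} {Fin.suc j} eq = cong Fin.suc (f-inj eq)

    Q[u◂f] : ∀ i → Q ((u ◂ f) i)
    Q[u◂f] Fin.zero    = Qu
    Q[u◂f] (Fin.suc i) = P⊆Q (Pf i)

  HasSize-unique : ∀ {P : Pred (Fin n) 0ℓ} {a b} → HasSize P a → HasSize P b → a ≡ b
  HasSize-unique P-a P-b =
    ℕ.≤-antisym (HasSize-⊆⇒≤ P-a P-b (λ Pu → Pu)) (HasSize-⊆⇒≤ P-b P-a (λ Pu → Pu))

-- Initial segments and convex sets of a Wheeler order

module _ {σ n : ℕ} {A : GNFA σ n} (W : WheelerOrder A) where
  open WheelerOrder W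
  open IsTotalOrder isTotalOrder using (total; antisym; reflexive) renaming (refl to ≤-refl)

  _≤?_ : Binary.Decidable _≤_
  _≤?_ = total∧dec⇒dec reflexive antisym total Fin._≟_

  DownwardClosed : Pred (Fin n) 0ℓ → Set
  DownwardClosed D = ∀ u v → u < v → D v → D u

  DownwardClosed⇒≐Interval : ∀ {D k} → DownwardClosed D → HasSize D k → D ≐ Interval W 1 k
  DownwardClosed⇒≐Interval {D} {k} D-closed D-size = D⇒Interval , Interval⇒D
    where
    D⇒Interval : ∀ {u} → D u → Interval W 1 k u
    D⇒Interval {u} Du =
      let p , ≤u-size = hasSize (_≤? u) in
      p , ≤u-size , HasSize⇒0< ≤u-size ≤-refl , HasSize-⊆⇒≤ ≤u-size D-size ≤u⇒D
      where
      ≤u⇒D : ∀ {v} → v ≤ u → D v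
      ≤u⇒D {v} v≤u with v Fin.≟ u
      ... | yes refl = Du
      ... | no  v≢u  = D-closed v u (v≤u , v≢u) Du

    Interval⇒D : ∀ {u} → Interval W 1 k u → D u
    Interval⇒D {u} (p , ≤u-size , _ , p≤k) with HasSize⇒Decidable D-size u
    ... | yes Du = Du
    ... | no ¬Du = contradiction (HasSize-⊂⇒< D-size ≤u-size D⇒≤u ≤-refl ¬Du) (ℕ.≤⇒≯ p≤k)
      where
      D⇒≤u : ∀ {v} → D v → v ≤ u
      D⇒≤u {v} Dv with total v u
      ... | inj₁ v≤u = v≤u
      ... | inj₂ u≤v = contradiction (D-closed u v (u≤v , λ { refl → ¬Du Dv }) Dv) ¬Du

  ≐Interval-difference : ∀ {P R : Pred (Fin n) 0ℓ} {k₁ k₂} → Empty (P ∩ R) →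
                         P ≐ Interval W 1 k₁ → (P ∪ R) ≐ Interval W 1 k₂ →
                         R ≐ Interval W (suc k₁) k₂
  ≐Interval-difference {P} {R} {k₁} {k₂} P∩R-empty (P⇒I₁ , I₁⇒P) (P∪R⇒I₂ , I₂⇒P∪R) = R⇒I , I⇒R
    where
    R⇒I : ∀ {u} → R u → Interval W (suc k₁) k₂ u
    R⇒I {u} Ru with p , ≤u-size , 1≤p , p≤k₂ ← P∪R⇒I₂ (inj₂ Ru) =
      p , ≤u-size , ℕ.≰⇒> (λ p≤k₁ → P∩R-empty u (I₁⇒P (p , ≤u-size , 1≤p , p≤k₁) , Ru)) , p≤k₂

    I⇒R : ∀ {u} → Interval W (suc k₁) k₂ u → R u
    I⇒R {u} (p , ≤u-size , k₁<p , p≤k₂) with I₂⇒P∪R (p , ≤u-size , ℕ.≤-trans (s≤s z≤n) k₁<p , p≤k₂)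
    ... | inj₂ Ru = Ru
    ... | inj₁ Pu with p′ , ≤u-size′ , _ , p′≤k₁ ← P⇒I₁ Pu =
      contradiction (subst (ℕ._≤ k₁) (HasSize-unique ≤u-size′ ≤u-size) p′≤k₁) (ℕ.<⇒≱ k₁<p)

  DownwardClosed-difference⇒Convex : ∀ {P R : Pred (Fin n) 0ℓ} → Empty (P ∩ R) →
    DownwardClosed P → DownwardClosed (P ∪ R) → Convex W R
  DownwardClosed-difference⇒Convex P∩R-empty P-closed P∪R-closed u v z Ru Rz u<v v<z
    with P∪R-closed v z v<z (inj₂ Rz)
  ... | inj₂ Rv = Rv
  ... | inj₁ Pv = contradiction (P-closed u v u<v Pv , Ru) (P∩R-empty u)

-- Downward closure of G^≺(α) and G^≺_⊣(α)

module _ {σ n : ℕ} (A : GNFA σ n) where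

  ⪯A⇒≺ : ∀ {u v β β′} → _⪯A_ A u v → I A u β → I A v β′ → ¬ (I A v β × I A u β′) → β ≺ β′
  ⪯A⇒≺ u⪯v uβ vβ′ ¬shared = u⪯v _ _ uβ vβ′ λ ((_ , vβ) , (uβ′ , _)) → ¬shared (vβ , uβ′)

  module _ (α : Str σ) where

    Gprec∩Gsuf-empty : Empty (Gprec A α ∩ Gsuf A α)
    Gprec∩Gsuf-empty u (u-prec , β , uβ , α⊣β) = ⊣⇒⊀ α⊣β (u-prec β uβ)

    Gprec-downward : ∀ {u v} → _⪯A_ A u v → ∃ (I A v) → Gprec A α v → Gprec A α u
    Gprec-downward u⪯v (β′ , vβ′) v-prec β uβ with β ≺? α
    ... | yes β≺α = β≺α
    ... | no  β⊀α = contradiction (≺-trans {_} {β} {β′} {α} β≺β′ (v-prec β′ vβ′)) β⊀α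
      where
      β≺β′ : β ≺ β′
      β≺β′ = ⪯A⇒≺ u⪯v uβ vβ′ λ (vβ , _) → β⊀α (v-prec β vβ)

    Gsuf⇒Gboth-downward : ∀ {u v} → Dec (Gsuf A α u) → _⪯A_ A u v → Gsuf A α v → Gboth A α u
    Gsuf⇒Gboth-downward (yes u-suf) _ _ = inj₂ u-suf
    Gsuf⇒Gboth-downward {u} (no ¬u-suf) u⪯v (β , vβ , α⊣β) = inj₁ u-prec
      where
      u-prec : Gprec A α u
      u-prec γ uγ with γ ≺? α
      ... | yes γ≺α = γ≺α
      ... | no  γ⊀α = contradiction (γ , uγ , ⊣-convex (⊀⇒⪰ γ⊀α) γ≺β α⊣β) ¬u-suf
        where
        γ≺β : γ ≺ β
        γ≺β = ⪯A⇒≺ u⪯v uγ vβ λ (_ , uβ) → ¬u-suf (β , uβ , α⊣β)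

lemma1 : ∀ {σ n : ℕ} (A : GNFA σ n) → WellFormed A → (W : WheelerOrder A) →
    ∀ (α : Str σ) →
    let open WheelerOrder W in
    Empty (Gprec A α ∩ Gsuf A α)
    × Convex W (Gsuf A α)
    × (∀ u v → u < v → Gprec A α v → Gprec A α u)
    × (∀ k → HasSize (Gprec A α) k → Gprec A α ≐ Interval W 1 k)
    × (∀ u v → u < v → Gboth A α v → Gboth A α u)
    × (∀ k → HasSize (Gboth A α) k → Gboth A α ≐ Interval W 1 k)
    × (∀ k₁ k₂ → HasSize (Gprec A α) k₁ → HasSize (Gboth A α) k₂ →
    Gsuf A α ≐ Interval W (suc k₁) k₂)
lemma1 A wf W α =
    Gprec∩Gsuf-empty A α
  , DownwardClosed-difference⇒Convex W (Gprec∩Gsuf-empty A α) Gprec-closed Gboth-closed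
  , Gprec-closed
  , (λ _ → DownwardClosed⇒≐Interval W Gprec-closed)
  , Gboth-closed
  , (λ _ → DownwardClosed⇒≐Interval W Gboth-closed)
  , λ _ _ Gprec-size Gboth-size → ≐Interval-difference W (Gprec∩Gsuf-empty A α)
      (DownwardClosed⇒≐Interval W Gprec-closed Gprec-size)
      (DownwardClosed⇒≐Interval W Gboth-closed Gboth-size)
  where
  open WheelerOrder W

  Gprec-closed : DownwardClosed W (Gprec A α)
  Gprec-closed u v (u≤v , _) = Gprec-downward A α (axiom1 u v u≤v) (WellFormed.reachable wf v)

  Gboth-closed : DownwardClosed W (Gboth A α)
  Gboth-closed u v u<v       (inj₁ v-prec) = inj₁ (Gprec-closed u v u<v v-prec)
  Gboth-closed u v (u≤v , _) (inj₂ v-suf)  =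
    Gsuf⇒Gboth-downward A α (Gsuf? A wf α u) (axiom1 u v u≤v) v-suf
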